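{- Let $K$ be a set, let $A=(X,S)$ and $B=(Y,T)$ be syntactic propositions over $K$, and let $R\subseteq X\times Y$ be a label-respecting binary relation. Then the following are equivalent: (i) (lax resolution condition) for every $t\in T$, the inverse image $R^{ -1}(t)=\{x:\exists y\in t,\ xRy\}$ contains some element of $S$, and for every $\alpha\in S^{\perp}$, the direct image $R(\alpha)=\{y:\exists x\in\alpha,\ xRy\}$ contains some element of $T^{\perp}$; (ii) for every $t\in T$ and every $\alpha\in S^{\perp}$ there is at least one pair $(x,y)$ with $x\in\alpha$, $y\in t$ and $xRy$.
   Context: For subsets $s,t$ of a set $X$, $s\perp t$ means $s\cap t$ has exactly one element; for a set $S$ of subsets of $X$, $S^{\perp}=\{t\subseteq X: t\perp s\ \forall s\in S\}$. An abstract proposition with labels in $K$ is a pair $(X,S)$, $X$ a set of leaves labelled by elements of $K$, $S$ a set of subsets of $X$ (resolutions) with $S^{\perp\perp}=S$; elements of $S^{\perp}$ are coresolutions. A syntactic proposition arises from a formula $\phi$ built from elements of $K$ with binary $\wedge,\vee$: $X$ is the set of leaf occurrences of $\phi$, $S$ the set of maximal sets of leaves no two of which meet at a $\wedge$-node of the parse tree of $\phi$. -}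

module Defs where

open import Data.Bool using (Bool; true; false)
open import Data.Product using (Σ; _×_; _,_)
open import Relation.Binary.PropositionalEquality using (_≡_)
open import Relation.Nullary using (¬_)

data Formula (K : Set) : Set where
  var : K → Formula K
  _∧_ : Formula K → Formula K → Formula K
  _∨_ : Formula K → Formula K → Formula K

-- Leaf occurrences of a formula (the set X of the syntactic proposition).
data Leaf {K : Set} : Formula K → Set where
  here : ∀ {k} → Leaf (var k)
  ∧l : ∀ {φ ψ} → Leaf φ → Leaf (φ ∧ ψ)
  ∧r : ∀ {φ ψ} → Leaf ψ → Leaf (φ ∧ ψ)
  ∨l : ∀ {φ ψ} → Leaf φ → Leaf (φ ∨ ψ)
  ∨r : ∀ {φ ψ} → Leaf ψ → Leaf (φ ∨ ψ)

label : {K : Set} {φ : Formula K} → Leaf φ → K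
label (here {k}) = k
label (∧l x) = label x
label (∧r x) = label x
label (∨l x) = label x
label (∨r x) = label x

-- x ⋏ y : the leaves x and y meet (lowest common ancestor) at a ∧-node.
data _⋏_ {K : Set} : {φ : Formula K} → Leaf φ → Leaf φ → Set where
  lr  : ∀ {φ ψ} {x : Leaf φ} {y : Leaf ψ} → ∧l {ψ = ψ} x ⋏ ∧r {φ = φ} y
  rl  : ∀ {φ ψ} {x : Leaf φ} {y : Leaf ψ} → ∧r {φ = φ} y ⋏ ∧l {ψ = ψ} x
  ∧ll : ∀ {φ ψ} {x x' : Leaf φ} → x ⋏ x' → ∧l {ψ = ψ} x ⋏ ∧l x'
  ∧rr : ∀ {φ ψ} {y y' : Leaf ψ} → y ⋏ y' → ∧r {φ = φ} y ⋏ ∧r y'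
  ∨ll : ∀ {φ ψ} {x x' : Leaf φ} → x ⋏ x' → ∨l {ψ = ψ} x ⋏ ∨l x'
  ∨rr : ∀ {φ ψ} {y y' : Leaf ψ} → y ⋏ y' → ∨r {φ = φ} y ⋏ ∨r y'

Subset : {K : Set} → Formula K → Set
Subset φ = Leaf φ → Bool

_∈_ : {K : Set} {φ : Formula K} → Leaf φ → Subset φ → Set
x ∈ s = s x ≡ true

_⊆_ : {K : Set} {φ : Formula K} → Subset φ → Subset φ → Set
s ⊆ s' = ∀ x → x ∈ s → x ∈ s'

Independent : {K : Set} {φ : Formula K} → Subset φ → Set
Independent s = ∀ x y → x ∈ s → y ∈ s → ¬ (x ⋏ y)

Resolution : {K : Set} (φ : Formula K) → Subset φ → Set
Resolution φ s = Independent s × (∀ s' → Independent s' → s ⊆ s' → s' ⊆ s)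

_⊥_ : {K : Set} {φ : Formula K} → Subset φ → Subset φ → Set
s ⊥ t = Σ _ λ x → x ∈ s × x ∈ t × (∀ y → y ∈ s → y ∈ t → y ≡ x)

Coresolution : {K : Set} (φ : Formula K) → Subset φ → Set
Coresolution φ t = ∀ s → Resolution φ s → s ⊥ t

Rel : {K : Set} → Formula K → Formula K → Set
Rel φ ψ = Leaf φ → Leaf ψ → Bool

LabelRespecting : {K : Set} {φ ψ : Formula K} → Rel φ ψ → Set
LabelRespecting R = ∀ x y → R x y ≡ true → label x ≡ label y

InvImage : {K : Set} {φ ψ : Formula K} → Rel φ ψ → Subset ψ → Leaf φ → Set
InvImage {ψ = ψ} R t x = Σ (Leaf ψ) λ y → y ∈ t × R x y ≡ true

DirImage : {K : Set} {φ ψ : Formula K} → Rel φ ψ → Subset φ → Leaf ψ → Set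
DirImage {φ = φ} R α y = Σ (Leaf φ) λ x → x ∈ α × R x y ≡ true

LaxResolution : {K : Set} (φ ψ : Formula K) → Rel φ ψ → Set
LaxResolution φ ψ R =
  (∀ t → Resolution ψ t → Σ (Subset φ) λ s → Resolution φ s × (∀ x → x ∈ s → InvImage R t x))
  × (∀ α → Coresolution φ α → Σ (Subset ψ) λ β → Coresolution ψ β × (∀ y → y ∈ β → DirImage R α y))

Condition2 : {K : Set} (φ ψ : Formula K) → Rel φ ψ → Set
Condition2 φ ψ R =
  ∀ t α → Resolution ψ t → Coresolution φ α →
    Σ (Leaf φ) λ x → Σ (Leaf ψ) λ y → x ∈ α × y ∈ t × R x y ≡ true

{-# OPTIONS --safe #-}

-- For a syntactic proposition, every decidable set u of leaves either contains a
-- resolution, or its complement contains a coresolution.  By induction on the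
-- formula: at a ∧-node a resolution of either conjunct (padded with nothing on the
-- other side) is a resolution of the conjunction, while coresolutions of both
-- conjuncts combine into one; at a ∨-node the roles are exchanged.
-- Given (ii), the second alternative is impossible for u = R⁻¹(t) and, dually,
-- for the complement of R(α); so (ii) gives (i).  Conversely a resolution
-- s ⊆ R⁻¹(t) meets every coresolution α, which gives (ii).
module Submission where

open import Defs
open import Data.Bool using (true; false)
open import Data.Bool.Properties using (_≟_)
open import Data.Empty using (⊥-elim)
open import Data.Product using (Σ; ∃; _×_; _,_; proj₁; proj₂; map)
open import Data.Sum using (_⊎_; inj₁; inj₂; [_,_])
open import Function using (_∘_; id)
open import Function.Bundles using (_⇔_; mk⇔)
open import Level using (0ℓ)
open import Relation.Binary.PropositionalEquality using (_≡_; refl; cong)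
open import Relation.Nullary using (¬_; Dec; yes; no)
open import Relation.Nullary.Decidable using (map′; _⊎-dec_; _×-dec_; ¬?; decidable-stable)
open import Relation.Unary using (Pred; Decidable; ∁)

module _ {K : Set} where

  private
    variable
      φ ψ χ : Formula K
      s t α β : Subset φ

  any? : (φ : Formula K) {P : Pred (Leaf φ) 0ℓ} → Decidable P → Dec (∃ P)
  any? (var k) P? = map′ (here ,_) (λ { (here , p) → p }) (P? here)
  any? (φ ∧ ψ) P? =
    map′ [ map ∧l id , map ∧r id ] (λ { (∧l x , p) → inj₁ (x , p) ; (∧r y , p) → inj₂ (y , p) })
      (any? φ (P? ∘ ∧l) ⊎-dec any? ψ (P? ∘ ∧r))
  any? (φ ∨ ψ) P? =
    map′ [ map ∨l id , map ∨r id ] (λ { (∨l x , p) → inj₁ (x , p) ; (∨r y , p) → inj₂ (y , p) })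
      (any? φ (P? ∘ ∨l) ⊎-dec any? ψ (P? ∘ ∨r))

  full : Subset φ
  full _ = true

  ∅ : Subset φ
  ∅ _ = false

  _∧ˢ_ : Subset φ → Subset ψ → Subset (φ ∧ ψ)
  (s ∧ˢ t) (∧l x) = s x
  (s ∧ˢ t) (∧r y) = t y

  _∨ˢ_ : Subset φ → Subset ψ → Subset (φ ∨ ψ)
  (s ∨ˢ t) (∨l x) = s x
  (s ∨ˢ t) (∨r y) = t y

  Nonempty : Subset φ → Set
  Nonempty {φ} s = Σ (Leaf φ) (_∈ s)

  _⊆ᴾ_ : Subset φ → Pred (Leaf φ) 0ℓ → Set
  s ⊆ᴾ u = ∀ x → x ∈ s → u x

  ∅-⊆ᴾ : {u : Pred (Leaf φ) 0ℓ} → ∅ ⊆ᴾ u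
  ∅-⊆ᴾ _ ()

  ∧ˢ-⊆ᴾ : {u : Pred (Leaf (φ ∧ ψ)) 0ℓ} → s ⊆ᴾ (u ∘ ∧l) → t ⊆ᴾ (u ∘ ∧r) → (s ∧ˢ t) ⊆ᴾ u
  ∧ˢ-⊆ᴾ s⊆ t⊆ (∧l x) = s⊆ x
  ∧ˢ-⊆ᴾ s⊆ t⊆ (∧r y) = t⊆ y

  ∨ˢ-⊆ᴾ : {u : Pred (Leaf (φ ∨ ψ)) 0ℓ} → s ⊆ᴾ (u ∘ ∨l) → t ⊆ᴾ (u ∘ ∨r) → (s ∨ˢ t) ⊆ᴾ u
  ∨ˢ-⊆ᴾ s⊆ t⊆ (∨l x) = s⊆ x
  ∨ˢ-⊆ᴾ s⊆ t⊆ (∨r y) = t⊆ y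

  Maximal : Subset φ → Set
  Maximal s = ∀ s' → Independent s' → s ⊆ s' → s' ⊆ s

  Independent-∘ : (f : Leaf φ → Leaf χ) → (∀ {x y} → x ⋏ y → f x ⋏ f y) →
    {s : Subset χ} → Independent s → Independent (s ∘ f)
  Independent-∘ f f-⋏ ind x y x∈s y∈s x⋏y = ind (f x) (f y) x∈s y∈s (f-⋏ x⋏y)

  Independent-∧ˢ∅ : Independent s → Independent (s ∧ˢ ∅ {φ = ψ})
  Independent-∧ˢ∅ ind (∧l x) (∧l y) x∈s y∈s (∧ll x⋏y) = ind x y x∈s y∈s x⋏y
  Independent-∧ˢ∅ ind (∧l x) (∧r y) _ ()
  Independent-∧ˢ∅ ind (∧r x) _ ()

  Independent-∅∧ˢ : Independent t → Independent (∅ {φ = φ} ∧ˢ t)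
  Independent-∅∧ˢ ind (∧r x) (∧r y) x∈t y∈t (∧rr x⋏y) = ind x y x∈t y∈t x⋏y
  Independent-∅∧ˢ ind (∧r x) (∧l y) _ ()
  Independent-∅∧ˢ ind (∧l x) _ ()

  Independent-∨ˢ : Independent s → Independent t → Independent (s ∨ˢ t)
  Independent-∨ˢ ind ind' (∨l x) (∨l y) x∈s y∈s (∨ll x⋏y) = ind x y x∈s y∈s x⋏y
  Independent-∨ˢ ind ind' (∨r x) (∨r y) x∈t y∈t (∨rr x⋏y) = ind' x y x∈t y∈t x⋏y

  resolution-var : ∀ {k} → Resolution (var k) full
  resolution-var = (λ _ _ _ _ ()) , (λ _ _ _ _ _ → refl)

  resolution-∨-split : Resolution (φ ∨ ψ) s → Resolution φ (s ∘ ∨l) × Resolution ψ (s ∘ ∨r)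
  resolution-∨-split {s = s} (ind , max) = (indˡ , maxˡ) , (indʳ , maxʳ)
    where
    indˡ : Independent (s ∘ ∨l)
    indˡ = Independent-∘ ∨l ∨ll ind

    indʳ : Independent (s ∘ ∨r)
    indʳ = Independent-∘ ∨r ∨rr ind

    maxˡ : Maximal (s ∘ ∨l)
    maxˡ s' ind' s⊆s' x =
      max (s' ∨ˢ (s ∘ ∨r)) (Independent-∨ˢ ind' indʳ) (λ { (∨l x) → s⊆s' x ; (∨r y) p → p }) (∨l x)

    maxʳ : Maximal (s ∘ ∨r)
    maxʳ s' ind' s⊆s' y =
      max ((s ∘ ∨l) ∨ˢ s') (Independent-∨ˢ indˡ ind') (λ { (∨l x) p → p ; (∨r y) → s⊆s' y }) (∨r y)

  resolution-∧-split : Resolution (φ ∧ ψ) s →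
      (Resolution φ (s ∘ ∧l) × ¬ Nonempty (s ∘ ∧r))
    ⊎ (Resolution ψ (s ∘ ∧r) × ¬ Nonempty (s ∘ ∧l))
  resolution-∧-split {φ = φ} {s = s} (ind , max) with any? φ (λ x → s (∧l x) ≟ true)
  ... | yes (x , x∈s) = inj₁ ((Independent-∘ ∧l ∧ll ind , maxˡ) , noʳ)
    where
    noʳ : ¬ Nonempty (s ∘ ∧r)
    noʳ (y , y∈s) = ind (∧l x) (∧r y) x∈s y∈s lr

    maxˡ : Maximal (s ∘ ∧l)
    maxˡ s' ind' s⊆s' x =
      max (s' ∧ˢ ∅) (Independent-∧ˢ∅ ind')
        (λ { (∧l x) → s⊆s' x ; (∧r y) y∈s → ⊥-elim (noʳ (y , y∈s)) }) (∧l x)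
  ... | no noˡ = inj₂ ((Independent-∘ ∧r ∧rr ind , maxʳ) , noˡ)
    where
    maxʳ : Maximal (s ∘ ∧r)
    maxʳ s' ind' s⊆s' y =
      max (∅ ∧ˢ s') (Independent-∅∧ˢ ind')
        (λ { (∧l x) x∈s → ⊥-elim (noˡ (x , x∈s)) ; (∧r y) → s⊆s' y }) (∧r y)

  resolution-nonempty : (φ : Formula K) {s : Subset φ} → Resolution φ s → Nonempty s
  resolution-nonempty (var k) (_ , max) = here , max full (proj₁ resolution-var) (λ _ _ → refl) here refl
  resolution-nonempty (φ ∧ ψ) r with resolution-∧-split r
  ... | inj₁ (rˡ , _) = map ∧l id (resolution-nonempty φ rˡ)
  ... | inj₂ (rʳ , _) = map ∧r id (resolution-nonempty ψ rʳ)
  resolution-nonempty (φ ∨ ψ) r = map ∨l id (resolution-nonempty φ (proj₁ (resolution-∨-split r)))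

  resolution-∧ˢ∅ : Resolution φ s → Resolution (φ ∧ ψ) (s ∧ˢ ∅)
  resolution-∧ˢ∅ {φ = φ} {s = s} r@(ind , max) = Independent-∧ˢ∅ ind , max'
    where
    max' : Maximal (s ∧ˢ ∅)
    max' s' ind' s⊆s' (∧l x) = max (s' ∘ ∧l) (Independent-∘ ∧l ∧ll ind') (s⊆s' ∘ ∧l) x
    max' s' ind' s⊆s' (∧r y) y∈s' with resolution-nonempty φ r
    ... | x , x∈s = ⊥-elim (ind' (∧l x) (∧r y) (s⊆s' (∧l x) x∈s) y∈s' lr)

  resolution-∅∧ˢ : Resolution ψ t → Resolution (φ ∧ ψ) (∅ ∧ˢ t)
  resolution-∅∧ˢ {ψ = ψ} {t = t} r@(ind , max) = Independent-∅∧ˢ ind , max'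
    where
    max' : Maximal (∅ ∧ˢ t)
    max' s' ind' t⊆s' (∧r y) = max (s' ∘ ∧r) (Independent-∘ ∧r ∧rr ind') (t⊆s' ∘ ∧r) y
    max' s' ind' t⊆s' (∧l x) x∈s' with resolution-nonempty ψ r
    ... | y , y∈t = ⊥-elim (ind' (∧r y) (∧l x) (t⊆s' (∧r y) y∈t) x∈s' rl)

  resolution-∨ˢ : Resolution φ s → Resolution ψ t → Resolution (φ ∨ ψ) (s ∨ˢ t)
  resolution-∨ˢ {s = s} {t = t} (ind , max) (ind' , max') = Independent-∨ˢ ind ind' , max''
    where
    max'' : Maximal (s ∨ˢ t)
    max'' s' ind'' ⊆s' (∨l x) = max (s' ∘ ∨l) (Independent-∘ ∨l ∨ll ind'') (⊆s' ∘ ∨l) x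
    max'' s' ind'' ⊆s' (∨r y) = max' (s' ∘ ∨r) (Independent-∘ ∨r ∨rr ind'') (⊆s' ∘ ∨r) y

  ⊥-from-∘ : (f : Leaf φ → Leaf χ) {s γ : Subset χ} →
    (∀ z → z ∈ s → z ∈ γ → Σ (Leaf φ) λ x → z ≡ f x) → (s ∘ f) ⊥ (γ ∘ f) → s ⊥ γ
  ⊥-from-∘ f {s} {γ} meet⊆im (x , x∈s , x∈γ , unique) = f x , x∈s , x∈γ , unique'
    where
    unique' : ∀ z → z ∈ s → z ∈ γ → z ≡ f x
    unique' z z∈s z∈γ with meet⊆im z z∈s z∈γ
    ... | y , refl = cong f (unique y z∈s z∈γ)

  coresolution-var : ∀ {k} → Coresolution (var k) full
  coresolution-var s r with resolution-nonempty _ r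
  ... | here , here∈s = here , here∈s , refl , λ { here _ _ → refl }

  coresolution-∧ˢ : Coresolution φ α → Coresolution ψ β → Coresolution (φ ∧ ψ) (α ∧ˢ β)
  coresolution-∧ˢ cα cβ s r with resolution-∧-split r
  ... | inj₁ (rˡ , noʳ) =
    ⊥-from-∘ ∧l (λ { (∧l x) _ _ → x , refl ; (∧r y) y∈s _ → ⊥-elim (noʳ (y , y∈s)) }) (cα _ rˡ)
  ... | inj₂ (rʳ , noˡ) =
    ⊥-from-∘ ∧r (λ { (∧r y) _ _ → y , refl ; (∧l x) x∈s _ → ⊥-elim (noˡ (x , x∈s)) }) (cβ _ rʳ)

  coresolution-∨ˢ∅ : Coresolution φ α → Coresolution (φ ∨ ψ) (α ∨ˢ ∅)
  coresolution-∨ˢ∅ cα s r =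
    ⊥-from-∘ ∨l (λ { (∨l x) _ _ → x , refl ; (∨r y) _ () }) (cα _ (proj₁ (resolution-∨-split r)))

  coresolution-∅∨ˢ : Coresolution ψ β → Coresolution (φ ∨ ψ) (∅ ∨ˢ β)
  coresolution-∅∨ˢ cβ s r =
    ⊥-from-∘ ∨r (λ { (∨r y) _ _ → y , refl ; (∨l x) _ () }) (cβ _ (proj₂ (resolution-∨-split r)))

  ResolutionWithin CoresolutionWithin : (φ : Formula K) → Pred (Leaf φ) 0ℓ → Set
  ResolutionWithin φ u = Σ (Subset φ) λ s → Resolution φ s × s ⊆ᴾ u
  CoresolutionWithin φ u = Σ (Subset φ) λ α → Coresolution φ α × α ⊆ᴾ u

  resolutionWithin-or-coresolutionWithin∁ : (φ : Formula K) {u : Pred (Leaf φ) 0ℓ} →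
    Decidable u → ResolutionWithin φ u ⊎ CoresolutionWithin φ (∁ u)
  resolutionWithin-or-coresolutionWithin∁ (var k) u? with u? here
  ... | yes p = inj₁ (full , resolution-var , λ { here _ → p })
  ... | no ¬p = inj₂ (full , coresolution-var , λ { here _ → ¬p })
  resolutionWithin-or-coresolutionWithin∁ (φ ∧ ψ) u?
    with resolutionWithin-or-coresolutionWithin∁ φ (u? ∘ ∧l)
       | resolutionWithin-or-coresolutionWithin∁ ψ (u? ∘ ∧r)
  ... | inj₁ (s , r , s⊆) | _ = inj₁ (s ∧ˢ ∅ , resolution-∧ˢ∅ r , ∧ˢ-⊆ᴾ s⊆ ∅-⊆ᴾ)
  ... | inj₂ _ | inj₁ (t , r , t⊆) = inj₁ (∅ ∧ˢ t , resolution-∅∧ˢ r , ∧ˢ-⊆ᴾ ∅-⊆ᴾ t⊆)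
  ... | inj₂ (α , cα , α⊆) | inj₂ (β , cβ , β⊆) = inj₂ (α ∧ˢ β , coresolution-∧ˢ cα cβ , ∧ˢ-⊆ᴾ α⊆ β⊆)
  resolutionWithin-or-coresolutionWithin∁ (φ ∨ ψ) u?
    with resolutionWithin-or-coresolutionWithin∁ φ (u? ∘ ∨l)
       | resolutionWithin-or-coresolutionWithin∁ ψ (u? ∘ ∨r)
  ... | inj₂ (α , cα , α⊆) | _ = inj₂ (α ∨ˢ ∅ , coresolution-∨ˢ∅ cα , ∨ˢ-⊆ᴾ α⊆ ∅-⊆ᴾ)
  ... | inj₁ _ | inj₂ (β , cβ , β⊆) = inj₂ (∅ ∨ˢ β , coresolution-∅∨ˢ cβ , ∨ˢ-⊆ᴾ ∅-⊆ᴾ β⊆)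
  ... | inj₁ (s , r , s⊆) | inj₁ (t , r' , t⊆) = inj₁ (s ∨ˢ t , resolution-∨ˢ r r' , ∨ˢ-⊆ᴾ s⊆ t⊆)

  coresolutionWithin-or-resolutionWithin∁ : (φ : Formula K) {u : Pred (Leaf φ) 0ℓ} →
    Decidable u → CoresolutionWithin φ u ⊎ ResolutionWithin φ (∁ u)
  coresolutionWithin-or-resolutionWithin∁ φ u? with resolutionWithin-or-coresolutionWithin∁ φ (¬? ∘ u?)
  ... | inj₁ within∁ = inj₂ within∁
  ... | inj₂ (α , cα , α⊆) = inj₁ (α , cα , λ x x∈α → decidable-stable (u? x) (α⊆ x x∈α))

  module _ {φ ψ : Formula K} (R : Rel φ ψ) where

    InvImage? : ∀ t → Decidable (InvImage R t)
    InvImage? t x = any? ψ (λ y → (t y ≟ true) ×-dec (R x y ≟ true))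

    DirImage? : ∀ α → Decidable (DirImage R α)
    DirImage? α y = any? φ (λ x → (α x ≟ true) ×-dec (R x y ≟ true))

    laxResolution⇒condition2 : LaxResolution φ ψ R → Condition2 φ ψ R
    laxResolution⇒condition2 (lax-res , _) t α rt cα with lax-res t rt
    ... | s , rs , s⊆R⁻¹t with cα s rs
    ... | x , x∈s , x∈α , _ with s⊆R⁻¹t x x∈s
    ... | y , y∈t , xRy = x , y , x∈α , y∈t , xRy

    condition2⇒laxResolution : Condition2 φ ψ R → LaxResolution φ ψ R
    condition2⇒laxResolution cond = lax-res , lax-cores
      where
      lax-res : ∀ t → Resolution ψ t → ResolutionWithin φ (InvImage R t)
      lax-res t rt with resolutionWithin-or-coresolutionWithin∁ φ (InvImage? t)
      ... | inj₁ within = within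
      ... | inj₂ (α , cα , α∩R⁻¹t≡∅) with cond t α rt cα
      ...   | x , y , x∈α , y∈t , xRy = ⊥-elim (α∩R⁻¹t≡∅ x x∈α (y , y∈t , xRy))

      lax-cores : ∀ α → Coresolution φ α → CoresolutionWithin ψ (DirImage R α)
      lax-cores α cα with coresolutionWithin-or-resolutionWithin∁ ψ (DirImage? α)
      ... | inj₁ within = within
      ... | inj₂ (t , rt , t∩Rα≡∅) with cond t α rt cα
      ...   | x , y , x∈α , y∈t , xRy = ⊥-elim (t∩Rα≡∅ y y∈t (x , x∈α , xRy))

proposition2 : {K : Set} (φ ψ : Formula K) (R : Rel φ ψ) → LabelRespecting R →
    LaxResolution φ ψ R ⇔ Condition2 φ ψ R
proposition2 φ ψ R _ = mk⇔ (laxResolution⇒condition2 R) (condition2⇒laxResolution R)
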